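{- Let $r \geq 2$ and $d \geq 1$, and let $G \in \mathcal{G}_d(r)$. Then for every vertex $v$ of $G$, $\deg(v) \leq \eta(r-1,d) \leq \eta(r-1)$.
   Context: A simple undirected graph is $(2,3)$-agreeable if any three vertices induce a subgraph with at least one edge. $\omega(G)$ is the clique number. The boxicity $\mathrm{box}(G)$ is the smallest $d$ such that $G$ is the intersection graph of a family of $d$-boxes (products of $d$ closed intervals), with the convention $\mathrm{box}(K_n)=0$. $\mathcal{G}_d(r)$ is the set of $(2,3)$-agreeable graphs with boxicity at most $d$ and clique number at most $r$; $\mathcal{G}(r)$ is the set of $(2,3)$-agreeable graphs with clique number at most $r$. $\eta(r,d)=\max\{\#V(G): G\in\mathcal{G}_d(r)\}$ and $\eta(r)=\max\{\#V(G): G\in\mathcal{G}(r)\}$.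
   Formalization: The d-boxes are products of closed intervals with rational endpoints, lying in ℚ^d rather than ℝ^d, so this affects the class $\mathcal{G}_d(r)$ and $\eta(r-1,d)$. -}

module Defs where

open import Data.Nat using (ℕ; zero; suc; _≤_; _<_)
open import Data.Fin using (Fin)
open import Data.Bool using (Bool; true; false)
open import Data.Product using (Σ; _×_; _,_)
open import Data.List using (List; length; filter)
open import Data.Fin.Base using () 
open import Data.List.Base using ()
open import Data.Vec.Functional using (Vector)
open import Data.Rational using (ℚ) renaming (_≤_ to _≤ℚ_)
open import Relation.Binary.PropositionalEquality using (_≡_; _≢_)
open import Relation.Nullary using (¬_; Dec)
open import Function.Definitions using (Injective)
open import Data.List using (allFin)
open import Data.Bool using (T)
open import Relation.Nullary.Decidable using (does)
open import Data.Bool.Properties using (T?)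

record Graph (n : ℕ) : Set where
  field
    adj     : Fin n → Fin n → Bool
    sym     : ∀ u v → adj u v ≡ adj v u
    irrefl  : ∀ v → adj v v ≡ false

open Graph public

Adj : ∀ {n} → Graph n → Fin n → Fin n → Set
Adj G u v = adj G u v ≡ true

#V : ∀ {n} → Graph n → ℕ
#V {n} _ = n

deg : ∀ {n} → Graph n → Fin n → ℕ
deg {n} G v = length (filter (λ u → T? (adj G v u)) (allFin n))

Agreeable23 : ∀ {n} → Graph n → Set
Agreeable23 {n} G = (x y z : Fin n) → x ≢ y → y ≢ z → x ≢ z →
  ¬ (¬ Adj G x y × ¬ Adj G y z × ¬ Adj G x z)

IsClique : ∀ {n k} → Graph n → (Fin k → Fin n) → Set
IsClique {n} {k} G f = Injective _≡_ _≡_ f × (∀ i j → i ≢ j → Adj G (f i) (f j))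

CliqueNumberAtMost : ∀ {n} → Graph n → ℕ → Set
CliqueNumberAtMost G r = ∀ k (f : Fin k → _) → IsClique G f → k ≤ r

record Box (d : ℕ) : Set where
  field
    lo    : Fin d → ℚ
    hi    : Fin d → ℚ
    valid : ∀ i → lo i ≤ℚ hi i

open Box public

BoxesIntersect : ∀ {d} → Box d → Box d → Set
BoxesIntersect B C = ∀ i → (lo B i ≤ℚ hi C i) × (lo C i ≤ℚ hi B i)

IsBoxRepresentation : ∀ {n} d → Graph n → (Fin n → Box d) → Set
IsBoxRepresentation {n} d G b =
  (u v : Fin n) → u ≢ v → (Adj G u v → BoxesIntersect (b u) (b v))
                        × (BoxesIntersect (b u) (b v) → Adj G u v)

-- box(G) ≤ d   (for d ≥ 1; complete graphs, of boxicity 0 by convention,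
-- are representable in every dimension d ≥ 1 by identical boxes)
BoxicityAtMost : ∀ {n} → Graph n → ℕ → Set
BoxicityAtMost {n} G d = Σ (Fin n → Box d) (IsBoxRepresentation d G)

InGd : ℕ → ℕ → ∀ {n} → Graph n → Set
InGd d r G = Agreeable23 G × BoxicityAtMost G d × CliqueNumberAtMost G r

InG : ℕ → ∀ {n} → Graph n → Set
InG r G = Agreeable23 G × CliqueNumberAtMost G r

IsEtaD : ℕ → ℕ → ℕ → Set
IsEtaD r d e = Σ (Graph e) (InGd d r) × (∀ {n} (G : Graph n) → InGd d r G → n ≤ e)

IsEta : ℕ → ℕ → Set
IsEta r e = Σ (Graph e) (InG r) × (∀ {n} (G : Graph n) → InG r G → n ≤ e)

-- The neighbourhood of v induces a graph in 𝒢_d(r-1): agreeability and box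
-- representations restrict to induced subgraphs, and every clique inside N(v)
-- extends by v, so N(v) has clique number at most r-1.  Hence deg v = |N(v)| is
-- at most η(r-1,d), and η(r-1,d) ≤ η(r-1) because 𝒢_d(r-1) ⊆ 𝒢(r-1).
module Submission where

open import Defs
open import Data.Nat using (ℕ; _≤_; _∸_; suc)
open import Data.Nat.Properties using (∸-monoˡ-≤)
open import Data.Fin using (Fin; zero; suc)
open import Data.Product using (_×_; _,_; proj₂)
open import Data.Bool.Properties using (T?; T-≡)
open import Data.List using (List; filter; allFin; lookup)
import Data.List.Relation.Unary.All as All
open import Data.List.Relation.Unary.Unique.Propositional using (Unique)
open import Data.List.Relation.Unary.AllPairs using (_∷_)
open import Data.List.Relation.Unary.Unique.Propositional.Properties using (filter⁺; allFin⁺)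
open import Data.List.Membership.Propositional.Properties using (∈-lookup; ∈-filter⁻)
open import Data.Vec.Functional using () renaming (_∷_ to _∷ᵛ_)
open import Data.Empty using (⊥-elim)
open import Function using (_∘_)
open import Function.Bundles using (Equivalence)
open import Function.Definitions using (Injective)
open import Relation.Binary.PropositionalEquality using (_≡_; _≢_; refl; trans; cong) renaming (sym to ≡-sym)

lookup-injective : ∀ {A : Set} {xs : List A} → Unique xs → Injective _≡_ _≡_ (lookup xs)
lookup-injective (_  ∷ _) {zero}  {zero}  _  = refl
lookup-injective (x∉ ∷ _) {zero}  {suc j} eq = ⊥-elim (All.lookup x∉ (∈-lookup j) eq)
lookup-injective (x∉ ∷ _) {suc i} {zero}  eq = ⊥-elim (All.lookup x∉ (∈-lookup i) (≡-sym eq))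
lookup-injective (_  ∷ u) {suc i} {suc j} eq = cong suc (lookup-injective u eq)

module _ {n : ℕ} (G : Graph n) where

  Adj-sym : ∀ {u v} → Adj G u v → Adj G v u
  Adj-sym {u} {v} uv = trans (Graph.sym G v u) uv

  Adj⇒≢ : ∀ {u v} → Adj G u v → u ≢ v
  Adj⇒≢ {u} uv refl with () ← trans (≡-sym (irrefl G u)) uv

  cons-isClique : ∀ {k v} {g : Fin k → Fin n} →
    IsClique G g → (∀ i → Adj G v (g i)) → IsClique G (v ∷ᵛ g)
  cons-isClique {v = v} {g} (g-inj , g-adj) v-adj = inj , adjacent
    where
    inj : Injective _≡_ _≡_ (v ∷ᵛ g)
    inj {zero}  {zero}  _  = refl
    inj {zero}  {suc j} eq = ⊥-elim (Adj⇒≢ (v-adj j) eq)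
    inj {suc i} {zero}  eq = ⊥-elim (Adj⇒≢ (v-adj i) (≡-sym eq))
    inj {suc i} {suc j} eq = cong suc (g-inj eq)

    adjacent : ∀ i j → i ≢ j → Adj G ((v ∷ᵛ g) i) ((v ∷ᵛ g) j)
    adjacent zero    zero    i≢j = ⊥-elim (i≢j refl)
    adjacent zero    (suc j) _   = v-adj j
    adjacent (suc i) zero    _   = Adj-sym (v-adj i)
    adjacent (suc i) (suc j) i≢j = g-adj i j (i≢j ∘ cong suc)

  induced : ∀ {m} → (Fin m → Fin n) → Graph m
  induced f = record
    { adj    = λ i j → adj G (f i) (f j)
    ; sym    = λ i j → Graph.sym G (f i) (f j)
    ; irrefl = λ i → irrefl G (f i)
    }

  module _ {m} {f : Fin m → Fin n} (f-inj : Injective _≡_ _≡_ f) where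

    private
      f-≢ : ∀ {i j} → i ≢ j → f i ≢ f j
      f-≢ i≢j = i≢j ∘ f-inj

    induced-agreeable : Agreeable23 G → Agreeable23 (induced f)
    induced-agreeable agr x y z x≢y y≢z x≢z = agr (f x) (f y) (f z) (f-≢ x≢y) (f-≢ y≢z) (f-≢ x≢z)

    induced-boxicity : ∀ {d} → BoxicityAtMost G d → BoxicityAtMost (induced f) d
    induced-boxicity (b , rep) = b ∘ f , λ i j i≢j → rep (f i) (f j) (f-≢ i≢j)

    induced-isClique : ∀ {k} {g : Fin k → Fin m} → IsClique (induced f) g → IsClique G (f ∘ g)
    induced-isClique (g-inj , g-adj) = g-inj ∘ f-inj , g-adj

  neighbours : Fin n → List (Fin n)
  neighbours v = filter (λ u → T? (adj G v u)) (allFin n)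

  neighbour : (v : Fin n) → Fin (deg G v) → Fin n
  neighbour v = lookup (neighbours v)

  neighbour-injective : ∀ v → Injective _≡_ _≡_ (neighbour v)
  neighbour-injective v = lookup-injective (filter⁺ _ (allFin⁺ n))

  neighbour-adjacent : ∀ v i → Adj G v (neighbour v i)
  neighbour-adjacent v i =
    Equivalence.to T-≡ (proj₂ (∈-filter⁻ (λ u → T? (adj G v u)) {xs = allFin n} (∈-lookup i)))

  neighbourhood : (v : Fin n) → Graph (deg G v)
  neighbourhood v = induced (neighbour v)

  neighbourhood-cliqueNumber : ∀ {r} v → CliqueNumberAtMost G r →
    CliqueNumberAtMost (neighbourhood v) (r ∸ 1)
  neighbourhood-cliqueNumber v ω≤r k g g-clique =
    ∸-monoˡ-≤ 1 (ω≤r (suc k) (v ∷ᵛ neighbour v ∘ g)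
      (cons-isClique (induced-isClique (neighbour-injective v) g-clique) (neighbour-adjacent v ∘ g)))

  neighbourhood-∈-𝒢d : ∀ {d r} v → InGd d r G → InGd d (r ∸ 1) (neighbourhood v)
  neighbourhood-∈-𝒢d v (agr , box , ω≤r) =
      induced-agreeable (neighbour-injective v) agr
    , induced-boxicity (neighbour-injective v) box
    , neighbourhood-cliqueNumber v ω≤r

deg≤ηd : ∀ {d r e n} (G : Graph n) → InGd d r G → IsEtaD (r ∸ 1) d e → ∀ v → deg G v ≤ e
deg≤ηd G G∈𝒢d (_ , maximal) v = maximal (neighbourhood G v) (neighbourhood-∈-𝒢d G v G∈𝒢d)

ηd≤η : ∀ {r d e e′} → IsEtaD r d e → IsEta r e′ → e ≤ e′
ηd≤η ((K , agr , _ , ω≤r) , _) (_ , maximal) = maximal K (agr , ω≤r)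

lemma4p3 : (r d : ℕ) → 2 ≤ r → 1 ≤ d →
    ∀ {n} (G : Graph n) → InGd d r G →
    (v : Fin n) → (e e′ : ℕ) → IsEtaD (r ∸ 1) d e → IsEta (r ∸ 1) e′ →
    deg G v ≤ e × e ≤ e′
lemma4p3 r d _ _ G G∈𝒢d v e e′ isηd isη = deg≤ηd G G∈𝒢d isηd v , ηd≤η isηd isη
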